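{- For every positive integer $n$, there exists an $n^2\times n^2$ Sudoku square whose main diagonal and secondary (anti-)diagonal each consist of distinct entries. That is, there is an $n^2\times n^2$ array with entries in $\{1,\dots,n^2\}$ such that the entries are pairwise distinct within each row, within each column, within each of the $n^2$ blocks, within the main diagonal (the cells in positions $(k,k)$, $1\le k\le n^2$), and within the secondary diagonal (the cells in positions $(k,n^2+1-k)$, $1\le k\le n^2$).
   Context: An $n^2\times n^2$ grid is partitioned into $n^2$ blocks, each an $n\times n$ sub-grid: for $1\le i,j\le n$, the $(i,j)$-block consists of the cells in rows $(i-1)n+1,\dots,in$ and columns $(j-1)n+1,\dots,jn$. An $n^2\times n^2$ Sudoku square is a filling of this grid with the integers $1,\dots,n^2$ such that each row, each column, and each block contains distinct entries (equivalently, each of the $n^2$ integers exactly once). -}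

module Defs where

open import Data.Nat using (ℕ; _*_; _+_; _∸_; _<_; suc; NonZero; _/_)
open import Data.Fin using (Fin; toℕ)
open import Data.Product using (_×_)
open import Relation.Binary.PropositionalEquality using (_≡_)
open import Relation.Nullary using (¬_)

-- A grid of size N×N: rows and columns indexed by Fin N (0-based),
-- entries in Fin N (entry e represents the integer toℕ e + 1).
Grid : ℕ → Set
Grid N = Fin N → Fin N → Fin N

Distinct : {N : ℕ} → (Fin N → Fin N) → Set
Distinct {N} f = ∀ (k l : Fin N) → f k ≡ f l → k ≡ l

SameBlock : (n : ℕ) .{{_ : NonZero n}} → Fin (n * n) → Fin (n * n) → Fin (n * n) → Fin (n * n) → Set
SameBlock n r c r' c' = (toℕ r / n ≡ toℕ r' / n) × (toℕ c / n ≡ toℕ c' / n)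

IsSudoku : (n : ℕ) .{{_ : NonZero n}} → Grid (n * n) → Set
IsSudoku n g =
  (∀ r → Distinct (λ c → g r c)) ×
  (∀ c → Distinct (λ r → g r c)) ×
  (∀ r c r' c' → SameBlock n r c r' c' → g r c ≡ g r' c' → r ≡ r' × c ≡ c')

-- Anti-diagonal index: k ↦ N - 1 - k (0-based), i.e. (k , N+1-k) 1-based.
open import Data.Fin using (opposite)

DiagonalSudoku : (n : ℕ) .{{_ : NonZero n}} → Grid (n * n) → Set
DiagonalSudoku n g =
  IsSudoku n g ×
  Distinct (λ k → g k k) ×
  Distinct (λ k → g k (opposite k))

-- Write row and column indices in base n, r = a n + b and c = a' n + b'. Cell (r, c) gets the
-- symbol whose base-n digits are (a + b + a' mod n, a + b' mod n). A row fixes a and b, a column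
-- a' and b', a block a and a'; in each case the two remaining digits are read back from the
-- symbol by cancellation in ℤ/n. On the diagonal (a' = a, b' = b) the high digit is the low
-- digit plus a, and on the anti-diagonal (a' = n-1-a, b' = n-1-b) the high digit is b + n - 1,
-- so there too the symbol determines a and b.
module Submission where

open import Defs
open import Data.Nat using (ℕ; _*_; NonZero)
open import Data.Product using (Σ)

open import Data.Nat using (suc; pred; _+_; _∸_; _<_; _%_; _/_; s≤s)
open import Data.Nat.Properties
  using (+-comm; +-assoc; *-suc; suc-pred; m+n∸n≡m; m+[n∸m]≡n; m∸n≤m; ≤-pred)
open import Data.Nat.DivMod
  using (_mod_; m%n<n; m<n⇒m%n≡m; [m+kn]%n≡m%n; %-distribˡ-+; m≡m%n+[m/n]*n;
         +-distrib-/-∣ʳ; m<n⇒m/n≡0; m*n/n≡m; m<n*o⇒m/o<n)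
open import Data.Nat.Divisibility using (n∣m*n)
open import Data.Nat.Tactic.RingSolver using (solve-∀)
open import Data.Fin using (Fin; toℕ; opposite; combine)
open import Data.Fin.Properties
  using (toℕ-injective; toℕ<n; toℕ-fromℕ<; opposite-prop; combine-injective)
open import Data.Product using (_,_; _×_)
open import Relation.Binary.PropositionalEquality
  using (_≡_; sym; trans; cong; cong₂; module ≡-Reasoning)

module Modular (n : ℕ) .{{_ : NonZero n}} where

  mod-injective : ∀ x y → x mod n ≡ y mod n → x % n ≡ y % n
  mod-injective x y e =
    trans (sym (toℕ-fromℕ< (m%n<n x n))) (trans (cong toℕ e) (toℕ-fromℕ< (m%n<n y n)))

  %-congˡ-+ : ∀ k x y → x % n ≡ y % n → (k + x) % n ≡ (k + y) % n
  %-congˡ-+ k x y e = begin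
    (k + x) % n             ≡⟨ %-distribˡ-+ k x n ⟩
    (k % n + x % n) % n     ≡⟨ cong (λ z → (k % n + z) % n) e ⟩
    (k % n + y % n) % n     ≡⟨ %-distribˡ-+ k y n ⟨
    (k + y) % n             ∎
    where open ≡-Reasoning

  %-congʳ-+ : ∀ k x y → x % n ≡ y % n → (x + k) % n ≡ (y + k) % n
  %-congʳ-+ k x y e = begin
    (x + k) % n ≡⟨ cong (_% n) (+-comm x k) ⟩
    (k + x) % n ≡⟨ %-congˡ-+ k x y e ⟩
    (k + y) % n ≡⟨ cong (_% n) (+-comm k y) ⟩
    (y + k) % n ∎
    where open ≡-Reasoning

  -- k · (n - 1) is an additive inverse of k modulo n.
  %-cancelˡ-+ : ∀ k x y → (k + x) % n ≡ (k + y) % n → x % n ≡ y % n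
  %-cancelˡ-+ k x y e = begin
    x % n                           ≡⟨ undo x ⟨
    (k * pred n + (k + x)) % n      ≡⟨ %-congˡ-+ (k * pred n) (k + x) (k + y) e ⟩
    (k * pred n + (k + y)) % n      ≡⟨ undo y ⟩
    y % n                           ∎
    where
    open ≡-Reasoning
    undo : ∀ z → (k * pred n + (k + z)) % n ≡ z % n
    undo z = begin
      (k * pred n + (k + z)) % n   ≡⟨ cong (_% n) (+-comm (k * pred n) (k + z)) ⟩
      (k + z + k * pred n) % n     ≡⟨ cong (λ w → (w + k * pred n) % n) (+-comm k z) ⟩
      (z + k + k * pred n) % n     ≡⟨ cong (_% n) (+-assoc z k (k * pred n)) ⟩
      (z + (k + k * pred n)) % n   ≡⟨ cong (λ w → (z + w) % n) (*-suc k (pred n)) ⟨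
      (z + k * suc (pred n)) % n   ≡⟨ cong (λ w → (z + k * w) % n) (suc-pred n) ⟩
      (z + k * n) % n              ≡⟨ [m+kn]%n≡m%n z k n ⟩
      z % n                        ∎

  %-cancelʳ-+ : ∀ k x y → (x + k) % n ≡ (y + k) % n → x % n ≡ y % n
  %-cancelʳ-+ k x y e =
    %-cancelˡ-+ k x y (trans (cong (_% n) (+-comm k x)) (trans e (cong (_% n) (+-comm y k))))

  m<n⇒[m+kn]%n≡m : ∀ {m} k → m < n → (m + k * n) % n ≡ m
  m<n⇒[m+kn]%n≡m {m} k m<n = trans ([m+kn]%n≡m%n m k n) (m<n⇒m%n≡m m<n)

  m<n⇒[m+kn]/n≡k : ∀ {m} k → m < n → (m + k * n) / n ≡ k
  m<n⇒[m+kn]/n≡k {m} k m<n = begin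
    (m + k * n) / n   ≡⟨ +-distrib-/-∣ʳ m (n∣m*n k) ⟩
    m / n + k * n / n ≡⟨ cong₂ _+_ (m<n⇒m/n≡0 m<n) (m*n/n≡m k n) ⟩
    k                 ∎
    where open ≡-Reasoning

module Digits (n : ℕ) .{{_ : NonZero n}} where

  hi : Fin (n * n) → ℕ
  hi r = toℕ r / n

  lo : Fin (n * n) → ℕ
  lo r = toℕ r % n

  hi<n : ∀ r → hi r < n
  hi<n r = m<n*o⇒m/o<n (toℕ<n r)

  lo<n : ∀ r → lo r < n
  lo<n r = m%n<n (toℕ r) n

  digits-injective : ∀ {r r'} → hi r ≡ hi r' → lo r ≡ lo r' → r ≡ r'
  digits-injective {r} {r'} a b = toℕ-injective (begin
    toℕ r             ≡⟨ m≡m%n+[m/n]*n (toℕ r) n ⟩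
    lo r + hi r * n   ≡⟨ cong₂ (λ u v → u + v * n) b a ⟩
    lo r' + hi r' * n ≡⟨ m≡m%n+[m/n]*n (toℕ r') n ⟨
    toℕ r'            ∎)
    where open ≡-Reasoning

  hi-%-injective : ∀ r r' → hi r % n ≡ hi r' % n → hi r ≡ hi r'
  hi-%-injective r r' e = trans (sym (m<n⇒m%n≡m (hi<n r))) (trans e (m<n⇒m%n≡m (hi<n r')))

  lo-%-injective : ∀ r r' → lo r % n ≡ lo r' % n → lo r ≡ lo r'
  lo-%-injective r r' e = trans (sym (m<n⇒m%n≡m (lo<n r))) (trans e (m<n⇒m%n≡m (lo<n r')))

module OppositeDigits (m : ℕ) where

  open Modular (suc m)
  open Digits (suc m)

  opposite-digits : ∀ r → toℕ (opposite r) ≡ (m ∸ lo r) + (m ∸ hi r) * suc m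
  opposite-digits r = begin
    toℕ (opposite r)                              ≡⟨ opposite-prop r ⟩
    n * n ∸ suc (toℕ r)                           ≡⟨ cong (λ w → n * n ∸ suc w) (m≡m%n+[m/n]*n (toℕ r) n) ⟩
    n * n ∸ suc (b + a * n)                       ≡⟨ cong (_∸ suc (b + a * n)) complement ⟨
    x + y * n + suc (b + a * n) ∸ suc (b + a * n) ≡⟨ m+n∸n≡m (x + y * n) (suc (b + a * n)) ⟩
    x + y * n                                     ∎
    where
    open ≡-Reasoning
    n = suc m
    a = hi r
    b = lo r
    x = m ∸ b
    y = m ∸ a
    regroup : ∀ x y b a n → x + y * n + suc (b + a * n) ≡ suc (b + x + (a + y) * n)
    regroup = solve-∀
    complement : x + y * n + suc (b + a * n) ≡ n * n
    complement = begin
      x + y * n + suc (b + a * n) ≡⟨ regroup x y b a n ⟩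
      suc (b + x + (a + y) * n)   ≡⟨ cong₂ (λ u v → suc (u + v * n))
                                       (m+[n∸m]≡n (≤-pred (lo<n r))) (m+[n∸m]≡n (≤-pred (hi<n r))) ⟩
      n * n                       ∎

  hi-opposite : ∀ r → hi (opposite r) ≡ m ∸ hi r
  hi-opposite r = trans (cong (_/ suc m) (opposite-digits r))
                        (m<n⇒[m+kn]/n≡k (m ∸ hi r) (s≤s (m∸n≤m m (lo r))))

  lo-opposite : ∀ r → lo (opposite r) ≡ m ∸ lo r
  lo-opposite r = trans (cong (_% suc m) (opposite-digits r))
                        (m<n⇒[m+kn]%n≡m (m ∸ hi r) (s≤s (m∸n≤m m (lo r))))

module Construction (m : ℕ) where

  n : ℕ
  n = suc m

  open Modular n
  open Digits n
  open OppositeDigits m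

  high : Fin (n * n) → Fin (n * n) → ℕ
  high r c = hi r + lo r + hi c

  low : Fin (n * n) → Fin (n * n) → ℕ
  low r c = hi r + lo c

  sudoku : Grid (n * n)
  sudoku r c = combine (high r c mod n) (low r c mod n)

  symbol-digits : ∀ r c r' c' → sudoku r c ≡ sudoku r' c' →
                  high r c % n ≡ high r' c' % n × low r c % n ≡ low r' c' % n
  symbol-digits r c r' c' e =
    let h , l = combine-injective (high r c mod n) (low r c mod n) (high r' c' mod n) (low r' c' mod n) e
    in mod-injective (high r c) (high r' c') h , mod-injective (low r c) (low r' c') l

  rows : ∀ r → Distinct (λ c → sudoku r c)
  rows r c c' e with symbol-digits r c r c' e
  ... | H , L = digits-injective
    (hi-%-injective c c' (%-cancelˡ-+ (hi r + lo r) (hi c) (hi c') H))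
    (lo-%-injective c c' (%-cancelˡ-+ (hi r) (lo c) (lo c') L))

  columns : ∀ c → Distinct (λ r → sudoku r c)
  columns c r r' e with symbol-digits r c r' c e
  ... | H , L = digits-injective a b
    where
    a : hi r ≡ hi r'
    a = hi-%-injective r r' (%-cancelʳ-+ (lo c) (hi r) (hi r') L)
    b : lo r ≡ lo r'
    b = lo-%-injective r r' (%-cancelˡ-+ (hi r) (lo r) (lo r')
          (%-cancelʳ-+ (hi c) (hi r + lo r) (hi r + lo r')
            (trans H (cong (λ w → (w + lo r' + hi c) % n) (sym a)))))

  blocks : ∀ r c r' c' → SameBlock n r c r' c' → sudoku r c ≡ sudoku r' c' → r ≡ r' × c ≡ c'
  blocks r c r' c' (a , a') e with symbol-digits r c r' c' e
  ... | H , L = digits-injective a b , digits-injective a' b'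
    where
    b : lo r ≡ lo r'
    b = lo-%-injective r r' (%-cancelˡ-+ (hi r) (lo r) (lo r')
          (%-cancelʳ-+ (hi c) (hi r + lo r) (hi r + lo r')
            (trans H (cong₂ (λ u v → (u + lo r' + v) % n) (sym a) (sym a')))))
    b' : lo c ≡ lo c'
    b' = lo-%-injective c c' (%-cancelˡ-+ (hi r) (lo c) (lo c')
           (trans L (cong (λ u → (u + lo c') % n) (sym a))))

  diagonal : Distinct (λ k → sudoku k k)
  diagonal k l e with symbol-digits k k l l e
  ... | H , L = digits-injective a b
    where
    a : hi k ≡ hi l
    a = hi-%-injective k l (%-cancelˡ-+ (hi k + lo k) (hi k) (hi l)
          (trans H (%-congʳ-+ (hi l) (hi l + lo l) (hi k + lo k) (sym L))))
    b : lo k ≡ lo l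
    b = lo-%-injective k l (%-cancelˡ-+ (hi k) (lo k) (lo l)
          (trans L (cong (λ u → (u + lo l) % n) (sym a))))

  high-opposite : ∀ k → high k (opposite k) ≡ lo k + m
  high-opposite k = begin
    hi k + lo k + hi (opposite k)  ≡⟨ cong (hi k + lo k +_) (hi-opposite k) ⟩
    hi k + lo k + (m ∸ hi k)       ≡⟨ cong (_+ (m ∸ hi k)) (+-comm (hi k) (lo k)) ⟩
    lo k + hi k + (m ∸ hi k)       ≡⟨ +-assoc (lo k) (hi k) (m ∸ hi k) ⟩
    lo k + (hi k + (m ∸ hi k))     ≡⟨ cong (lo k +_) (m+[n∸m]≡n (≤-pred (hi<n k))) ⟩
    lo k + m                       ∎
    where open ≡-Reasoning

  anti-diagonal : Distinct (λ k → sudoku k (opposite k))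
  anti-diagonal k l e with symbol-digits k (opposite k) l (opposite l) e
  ... | H , L = digits-injective a b
    where
    b : lo k ≡ lo l
    b = lo-%-injective k l (%-cancelʳ-+ m (lo k) (lo l)
          (trans (cong (_% n) (sym (high-opposite k))) (trans H (cong (_% n) (high-opposite l)))))
    a : hi k ≡ hi l
    a = hi-%-injective k l (%-cancelʳ-+ (m ∸ lo l) (hi k) (hi l) (begin
      (hi k + (m ∸ lo l)) % n          ≡⟨ cong (λ u → (hi k + (m ∸ u)) % n) b ⟨
      (hi k + (m ∸ lo k)) % n          ≡⟨ cong (λ u → (hi k + u) % n) (lo-opposite k) ⟨
      low k (opposite k) % n           ≡⟨ L ⟩
      low l (opposite l) % n           ≡⟨ cong (λ u → (hi l + u) % n) (lo-opposite l) ⟩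
      (hi l + (m ∸ lo l)) % n          ∎))
      where open ≡-Reasoning

  diagonal-sudoku : DiagonalSudoku n sudoku
  diagonal-sudoku = (rows , columns , blocks) , diagonal , anti-diagonal

theorem2 : (n : ℕ) .{{_ : NonZero n}} → Σ (Grid (n * n)) (λ g → DiagonalSudoku n g)
theorem2 (suc m) = sudoku , diagonal-sudoku
  where open Construction m
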